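{- Fix a graph $H$, an integer $s\ge 1$ and a constant $K\ge 1$. Consider a sequence (indexed by $n\to\infty$) of bipartite graphs $G$ with bipartition $A\cup B$ that are $K$-almost regular with minimum degree $\delta=\delta(n)$, together with a vertex $y\in A$ and a set $Y\subseteq N_b(y)$ of blue neighbours of $y$ in $G_c(A)$ (defined relative to $H$), such that $|Y|/\delta\to\infty$. Then there is a constant $c>0$ such that, for all sufficiently large $n$, the number of proper blue $s$-stars in $G_c(A)$ centred at $y$ whose $s$ leaves all lie in $Y$ is at least $c\,|Y|^s$.
   Context: A graph $G$ is $K$-almost regular if every vertex has degree in $[\delta,K\delta]$, where $\delta$ is the minimum degree of $G$. For $u,v\in A$, $N_G(u,v)\subseteq B$ is the set of common neighbours of $u$ and $v$ in $G$. The coloured graph $G_c(A)$ relative to the fixed graph $H$ (with $e(H)$ edges) is the graph on vertex set $A$ in which a pair $\{u,v\}$ is a red edge if $|N_G(u,v)|\ge e(H)$, a blue edge if $1\le |N_G(u,v)|\le e(H)-1$, and uncoloured if $N_G(u,v)=\emptyset$. $N_b(y)$ is the set of vertices joined to $y$ by a blue edge. An $s$-star centred at $y$ with leaves $u_1,\dots,u_s$ (distinct vertices of $A\setminus\{y\}$) is blue if every pair $\{y,u_i\}$ is a blue edge, and it is proper if one can choose pairwise distinct vertices $b_1,\dots,b_s\in B$ with $b_i\in N_G(y,u_i)$ for each $i$ (so that the $1$-subdivision of the star embeds in $G$). Stars are counted by their sets of leaves. -}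

module Defs where

open import Data.Bool using (Bool; true; false; _∧_; T)
open import Data.Nat using (ℕ; zero; suc; _+_; _*_; _∸_; _^_; _≤_; _<ᵇ_)
open import Data.Fin using (Fin; toℕ)
import Data.Fin as F
open import Data.Fin.Subset using (Subset; _∈_; _⊆_; ∣_∣)
open import Data.Product using (Σ; ∃; _×_; _,_)
open import Data.Sum using (_⊎_)
open import Data.List using (List; length)
open import Data.List.Relation.Unary.All using (All)
open import Data.List.Relation.Unary.Unique.Propositional using (Unique)
open import Relation.Binary.PropositionalEquality using (_≡_; _≢_)
import Data.Rational as Q

countᶠ : (n : ℕ) → (Fin n → Bool) → ℕ
countᶠ zero    p = 0
countᶠ (suc n) p with p F.zero
... | true  = suc (countᶠ n (λ i → p (F.suc i)))
... | false = countᶠ n (λ i → p (F.suc i))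

sumᶠ : (n : ℕ) → (Fin n → ℕ) → ℕ
sumᶠ zero    f = 0
sumᶠ (suc n) f = f F.zero + sumᶠ n (λ i → f (F.suc i))

ℕ→ℚ : ℕ → Q.ℚ
ℕ→ℚ n = Q._/_ (ℤ+ n) 1
  where open import Data.Integer using () renaming (+_ to ℤ+)

record SimpleGraph : Set where
  field
    v      : ℕ
    adj    : Fin v → Fin v → Bool
    sym    : ∀ i j → adj i j ≡ adj j i
    irrefl : ∀ i → adj i i ≡ false

edges : SimpleGraph → ℕ
edges H = sumᶠ v (λ i → countᶠ v (λ j → (toℕ i <ᵇ toℕ j) ∧ adj i j))
  where open SimpleGraph H

record BipGraph : Set where
  field
    a : ℕ
    b : ℕ
    E : Fin a → Fin b → Bool

module _ (G : BipGraph) where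
  open BipGraph G

  degA : Fin a → ℕ
  degA u = countᶠ b (E u)

  degB : Fin b → ℕ
  degB w = countᶠ a (λ u → E u w)

  IsMinDegree : ℕ → Set
  IsMinDegree δ =
    (∀ u → δ ≤ degA u) × (∀ w → δ ≤ degB w) ×
    ((∃ λ u → degA u ≡ δ) ⊎ (∃ λ w → degB w ≡ δ))

  AlmostRegular : Q.ℚ → ℕ → Set
  AlmostRegular K δ =
    IsMinDegree δ ×
    (∀ u → ℕ→ℚ (degA u) Q.≤ K Q.* ℕ→ℚ δ) ×
    (∀ w → ℕ→ℚ (degB w) Q.≤ K Q.* ℕ→ℚ δ)

  codeg : Fin a → Fin a → ℕ
  codeg u u' = countᶠ b (λ w → E u w ∧ E u' w)

  Blue : SimpleGraph → Fin a → Fin a → Set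
  Blue H u u' = u ≢ u' × 1 ≤ codeg u u' × codeg u u' ≤ edges H ∸ 1

  BlueNbrs : SimpleGraph → Fin a → Subset a → Set
  BlueNbrs H y Y = ∀ u → u ∈ Y → Blue H y u

  ProperBlueStar : SimpleGraph → ℕ → Fin a → Subset a → Set
  ProperBlueStar H s y L =
    ∣ L ∣ ≡ s ×
    (∀ u → u ∈ L → Blue H y u) ×
    (∃ λ (g : Fin a → Fin b) →
       (∀ u → u ∈ L → T (E y (g u) ∧ E u (g u))) ×
       (∀ u u' → u ∈ L → u' ∈ L → g u ≡ g u' → u ≡ u'))

  -- the number of proper blue s-stars centred at y with all leaves in Y
  -- (stars counted by their leaf sets) is at least m
  StarCountAtLeast : SimpleGraph → ℕ → Fin a → Subset a → Q.ℚ → Set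
  StarCountAtLeast H s y Y m =
    ∃ λ (Ls : List (Subset a)) →
      Unique Ls ×
      All (λ L → L ⊆ Y × ProperBlueStar H s y L) Ls ×
      m Q.≤ ℕ→ℚ (length Ls)

record Instance : Set where
  field
    G : BipGraph
    y : Fin (BipGraph.a G)
    Y : Subset (BipGraph.a G)

-- For every u ∈ Y fix a common neighbour φ(u) ∈ B of y and u. A leaf set on which φ is
-- injective spans a proper blue star (take b_i = φ(u_i)), and a fibre of φ lies in the
-- neighbourhood of a single vertex of B, so it has at most d ≤ Kδ elements. Order Y by the
-- index of φ(u) and cut it at thresholds into s consecutive blocks of at least r = ⌊|Y|/2s⌋
-- elements each: the number of elements above a threshold drops by at most d per step, so
-- such cuts exist as long as s(r + d) ≤ |Y|, which holds once |Y| ≥ 2sKδ. Choosing one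
-- element from each block gives r^s distinct leaf sets on which φ is injective, and
-- |Y| ≤ 4sr, so there are at least |Y|^s / (4s)^s proper blue stars.

module Submission where

open import Defs
open import Data.Nat using (ℕ; _≤_; _*_; _^_)
open import Data.Fin.Subset using (∣_∣)
open import Data.Product using (Σ; ∃; _×_)
import Data.Rational as Q

open import Data.Bool using (Bool; true; false; _∧_; not; T)
open import Data.Bool.Properties using (T-∧; T-≡; T-not-≡)
open import Data.Empty using (⊥; ⊥-elim)
open import Data.Fin using (Fin; zero; suc; toℕ; fromℕ<)
open import Data.Fin.Properties using (any?; toℕ<n; toℕ-injective; toℕ-fromℕ<)
open import Data.Fin.Subset using (Subset; ⁅_⁆; _∪_; _∉_; _⊆_; inside; outside)
  renaming (_∈_ to _∈ₛ_; ⊥ to ∅)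
open import Data.Fin.Subset.Properties
  using (∣⊥∣≡0; ∉⊥; x∈⁅x⁆; x∈⁅y⁆⇒x≡y; x∈p∪q⁻; x∈p∪q⁺; ⊆-antisym; ∪-identityˡ)
import Data.Integer as ℤ
import Data.Integer.Properties as ℤ
open import Data.List
  using (List; []; _∷_; length; map; filterᵇ; allFin; tabulate; cartesianProduct; _++_)
open import Data.List.Properties using (length-map; length-++)
open import Data.List.Membership.Propositional using (_∈_)
open import Data.List.Membership.Propositional.Properties using (∈-cartesianProduct⁻; ∈-filter⁻)
open import Data.List.Relation.Unary.All as All using (All)
import Data.List.Relation.Unary.All.Properties as All
open import Data.List.Relation.Unary.Any using (here; there)
open import Data.List.Relation.Unary.Unique.Propositional using (Unique)
import Data.List.Relation.Unary.Unique.Propositional.Properties as Unique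
open import Data.Nat
  using (zero; suc; _+_; _<_; _≤ᵇ_; _≡ᵇ_; z≤n; s≤s; _≤?_; _<?_; _/_; _%_; NonZero; >-nonZero)
open import Data.Nat.Coprimality using (Coprime; 1-coprimeTo)
import Data.Nat.Coprimality as Coprime
open import Data.Nat.DivMod using (m≡m%n+[m/n]*n; m%n<n; m/n*n≤m; m≥n⇒m/n>0)
open import Data.Nat.Properties
open import Algebra.Properties.CommutativeSemigroup *-commutativeSemigroup
  using () renaming (interchange to *-interchange)
open import Data.Nat.Tactic.RingSolver using (solve-∀)
open import Data.Product using (_,_; proj₁; proj₂)
import Data.Rational.Properties as ℚ
open import Data.Sum using (_⊎_; inj₁; inj₂)
import Data.Sum as Sum
open import Data.Unit using (tt)
import Data.Vec as Vec
import Data.Vec.Properties as Vec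
open import Function using (_∘_; id; Equivalence)
open import Relation.Binary.PropositionalEquality
open import Relation.Nullary using (yes; no; ¬_)
open import Relation.Nullary.Decidable using (T?)

open Equivalence using (to; from)

T-∧⁻ : ∀ x {y} → T (x ∧ y) → T x × T y
T-∧⁻ x = to (T-∧ {x})

T-∧⁺ : ∀ {x y} → T x × T y → T (x ∧ y)
T-∧⁺ = from T-∧

not-≤ᵇ⇒> : ∀ {m n} → T (not (m ≤ᵇ n)) → n < m
not-≤ᵇ⇒> h = ≰⇒> (λ m≤n → subst T (to T-not-≡ h) (≤⇒≤ᵇ m≤n))

countᶠ-mono : ∀ n {p q : Fin n → Bool} → (∀ i → T (p i) → T (q i)) → countᶠ n p ≤ countᶠ n q
countᶠ-mono zero    p⇒q = z≤n
countᶠ-mono (suc n) {p} {q} p⇒q with p zero in p₀ | q zero in q₀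
... | true  | true  = s≤s (countᶠ-mono n (λ i → p⇒q (suc i)))
... | true  | false = ⊥-elim (subst T q₀ (p⇒q zero (subst T (sym p₀) tt)))
... | false | true  = m≤n⇒m≤1+n (countᶠ-mono n (λ i → p⇒q (suc i)))
... | false | false = countᶠ-mono n (λ i → p⇒q (suc i))

countᶠ-cong : ∀ n {p q : Fin n → Bool} →
  (∀ i → T (p i) → T (q i)) → (∀ i → T (q i) → T (p i)) → countᶠ n p ≡ countᶠ n q
countᶠ-cong n p⇒q q⇒p = ≤-antisym (countᶠ-mono n p⇒q) (countᶠ-mono n q⇒p)

countᶠ-none : ∀ n {p : Fin n → Bool} → (∀ i → ¬ T (p i)) → countᶠ n p ≡ 0
countᶠ-none n ¬p = n≤0⇒n≡0 (≤-trans (countᶠ-mono n (λ i pᵢ → ⊥-elim (¬p i pᵢ))) (countᶠ-false n))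
  where
  countᶠ-false : ∀ n → countᶠ n (λ _ → false) ≤ 0
  countᶠ-false zero    = z≤n
  countᶠ-false (suc n) = countᶠ-false n

countᶠ-split : ∀ n (p q : Fin n → Bool) →
  countᶠ n p ≡ countᶠ n (λ i → p i ∧ q i) + countᶠ n (λ i → p i ∧ not (q i))
countᶠ-split zero    p q = refl
countᶠ-split (suc n) p q with p zero | q zero
... | true  | true  = cong suc (countᶠ-split n _ _)
... | true  | false = trans (cong suc (countᶠ-split n _ _)) (sym (+-suc _ _))
... | false | _     = countᶠ-split n _ _

countᶠ-pos : ∀ n {p : Fin n → Bool} i → T (p i) → 1 ≤ countᶠ n p
countᶠ-pos (suc n) {p} i pᵢ with p zero in p₀
countᶠ-pos (suc n) {p} i       pᵢ | true  = s≤s z≤n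
countᶠ-pos (suc n) {p} zero    pᵢ | false = ⊥-elim (subst T p₀ pᵢ)
countᶠ-pos (suc n) {p} (suc i) pᵢ | false = countᶠ-pos n i pᵢ

countᶠ-witness : ∀ n {p : Fin n → Bool} → 1 ≤ countᶠ n p → ∃ λ i → T (p i)
countᶠ-witness (suc n) {p} h with p zero in p₀
... | true  = zero , subst T (sym p₀) tt
... | false = let i , pᵢ = countᶠ-witness n h in suc i , pᵢ

length-filterᵇ-tabulate : ∀ {m} n (f : Fin n → Fin m) (p : Fin m → Bool) →
  length (filterᵇ p (tabulate f)) ≡ countᶠ n (p ∘ f)
length-filterᵇ-tabulate zero    f p = refl
length-filterᵇ-tabulate (suc n) f p with p (f zero)
... | true  = cong suc (length-filterᵇ-tabulate n (f ∘ suc) p)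
... | false = length-filterᵇ-tabulate n (f ∘ suc) p

∣p∣≡countᶠ : ∀ {n} (p : Subset n) → ∣ p ∣ ≡ countᶠ n (Vec.lookup p)
∣p∣≡countᶠ Vec.[]              = refl
∣p∣≡countᶠ (inside  Vec.∷ p) = cong suc (∣p∣≡countᶠ p)
∣p∣≡countᶠ (outside Vec.∷ p) = ∣p∣≡countᶠ p

∣⁅x⁆∪p∣≡1+∣p∣ : ∀ {n} (x : Fin n) (p : Subset n) → x ∉ p → ∣ ⁅ x ⁆ ∪ p ∣ ≡ suc ∣ p ∣
∣⁅x⁆∪p∣≡1+∣p∣ zero    (inside  Vec.∷ p) x∉p = ⊥-elim (x∉p Vec.here)
∣⁅x⁆∪p∣≡1+∣p∣ zero    (outside Vec.∷ p) x∉p = cong (λ q → suc ∣ q ∣) (∪-identityˡ p)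
∣⁅x⁆∪p∣≡1+∣p∣ (suc x) (inside  Vec.∷ p) x∉p = cong suc (∣⁅x⁆∪p∣≡1+∣p∣ x p (x∉p ∘ Vec.there))
∣⁅x⁆∪p∣≡1+∣p∣ (suc x) (outside Vec.∷ p) x∉p = ∣⁅x⁆∪p∣≡1+∣p∣ x p (x∉p ∘ Vec.there)

⁅x⁆∪-injective : ∀ {n} {x x′ : Fin n} {p p′ : Subset n} →
  x ∉ p → x ∉ p′ → x′ ∉ p → x′ ∉ p′ → ⁅ x ⁆ ∪ p ≡ ⁅ x′ ⁆ ∪ p′ → x ≡ x′ × p ≡ p′
⁅x⁆∪-injective {x = x} {x′} {p} {p′} x∉p x∉p′ x′∉p x′∉p′ eq = x≡x′ , ⊆-antisym p⊆p′ p′⊆p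
  where
  x≡x′ : x ≡ x′
  x≡x′ with x∈p∪q⁻ ⁅ x′ ⁆ p′ (subst (x ∈ₛ_) eq (x∈p∪q⁺ (inj₁ (x∈⁅x⁆ x))))
  ... | inj₁ x∈⁅x′⁆ = x∈⁅y⁆⇒x≡y x′ x∈⁅x′⁆
  ... | inj₂ x∈p′   = ⊥-elim (x∉p′ x∈p′)
  p⊆p′ : p ⊆ p′
  p⊆p′ {z} z∈p with x∈p∪q⁻ ⁅ x′ ⁆ p′ (subst (z ∈ₛ_) eq (x∈p∪q⁺ (inj₂ z∈p)))
  ... | inj₁ z∈⁅x′⁆ = ⊥-elim (x′∉p (subst (_∈ₛ p) (x∈⁅y⁆⇒x≡y x′ z∈⁅x′⁆) z∈p))
  ... | inj₂ z∈p′   = z∈p′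
  p′⊆p : p′ ⊆ p
  p′⊆p {z} z∈p′ with x∈p∪q⁻ ⁅ x ⁆ p (subst (z ∈ₛ_) (sym eq) (x∈p∪q⁺ (inj₂ z∈p′)))
  ... | inj₁ z∈⁅x⁆ = ⊥-elim (x∉p′ (subst (_∈ₛ p′) (x∈⁅y⁆⇒x≡y x z∈⁅x⁆) z∈p′))
  ... | inj₂ z∈p   = z∈p

Unique-map⁺ : ∀ {A B : Set} {f : A → B} {xs : List A} →
  (∀ {x x′} → x ∈ xs → x′ ∈ xs → f x ≡ f x′ → x ≡ x′) → Unique xs → Unique (map f xs)
Unique-map⁺ {xs = []}     inj Unique.[] = Unique.[]
Unique-map⁺ {xs = x ∷ xs} inj (x∉xs Unique.∷ xs!) =
  All.map⁺ (All.tabulate λ x′∈xs fx≡fx′ → All.lookup x∉xs x′∈xs (inj (here refl) (there x′∈xs) fx≡fx′))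
  Unique.∷ Unique-map⁺ (λ x∈ x′∈ → inj (there x∈) (there x′∈)) xs!

length-cartesianProduct : ∀ {A B : Set} (xs : List A) (ys : List B) →
  length (cartesianProduct xs ys) ≡ length xs * length ys
length-cartesianProduct []       ys = refl
length-cartesianProduct (x ∷ xs) ys = begin
  length (map (x ,_) ys ++ cartesianProduct xs ys)
    ≡⟨ length-++ (map (x ,_) ys) ⟩
  length (map (x ,_) ys) + length (cartesianProduct xs ys)
    ≡⟨ cong₂ _+_ (length-map (x ,_) ys) (length-cartesianProduct xs ys) ⟩
  length ys + length xs * length ys
    ∎
  where open ≡-Reasoning

descends-through-window : (c : ℕ → ℕ) (B d X : ℕ) →
  (∀ t → c t ≤ d + c (suc t)) → (∀ t → B ≤ t → c t ≡ 0) →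
  ∀ t → X ≤ c t → ∃ λ t′ → t ≤ t′ × X ≤ c t′ × c t′ ≤ d + X
descends-through-window c B d X step vanish t = go B t (m≤m+n B t)
  where
  go : ∀ k t → B ≤ k + t → X ≤ c t → ∃ λ t′ → t ≤ t′ × X ≤ c t′ × c t′ ≤ d + X
  go zero    t B≤t X≤cₜ = t , ≤-refl , X≤cₜ , ≤-trans (≤-reflexive (vanish t B≤t)) z≤n
  go (suc k) t B≤k+t X≤cₜ with X ≤? c (suc t)
  ... | no  X≰cₜ₊₁ = t , ≤-refl , X≤cₜ , ≤-trans (step t) (+-monoʳ-≤ d (<⇒≤ (≰⇒> X≰cₜ₊₁)))
  ... | yes X≤cₜ₊₁ =
    let t′ , t+1≤t′ , rest = go k (suc t) (≤-trans B≤k+t (≤-reflexive (sym (+-suc k t)))) X≤cₜ₊₁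
    in t′ , ≤-trans (n≤1+n t) t+1≤t′ , rest

module SpreadSets {n : ℕ} (Yp : Fin n → Bool) (key : Fin n → ℕ) (B d r : ℕ)
  (key<B : ∀ u → key u < B)
  (fibre≤d : ∀ t → countᶠ n (λ u → Yp u ∧ (key u ≡ᵇ t)) ≤ d) where

  Above : ℕ → Fin n → Bool
  Above t u = (t ≤ᵇ key u) ∧ Yp u

  Between : ℕ → ℕ → Fin n → Bool
  Between t t′ u = Above t u ∧ not (t′ ≤ᵇ key u)

  #Above : ℕ → ℕ
  #Above t = countᶠ n (Above t)

  #Between : ℕ → ℕ → ℕ
  #Between t t′ = countᶠ n (Between t t′)

  above⇒≤ : ∀ {t u} → T (Above t u) → t ≤ key u
  above⇒≤ {t} {u} h = ≤ᵇ⇒≤ t (key u) (proj₁ (T-∧⁻ (t ≤ᵇ key u) h))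

  above-antitone : ∀ {t t′ u} → t ≤ t′ → T (Above t′ u) → T (Above t u)
  above-antitone {t} {t′} {u} t≤t′ h =
    T-∧⁺ (≤⇒≤ᵇ (≤-trans t≤t′ (above⇒≤ h)) , proj₂ (T-∧⁻ (t′ ≤ᵇ key u) h))

  between⇒above : ∀ {t t′ u} → T (Between t t′ u) → T (Above t u)
  between⇒above {t} {u = u} h = proj₁ (T-∧⁻ (Above t u) h)

  between⇒< : ∀ {t t′ u} → T (Between t t′ u) → key u < t′
  between⇒< {t} {u = u} h = not-≤ᵇ⇒> (proj₂ (T-∧⁻ (Above t u) h))

  #Above-split : ∀ {t t′} → t ≤ t′ → #Above t ≡ #Between t t′ + #Above t′
  #Above-split {t} {t′} t≤t′ = begin
    #Above t
      ≡⟨ countᶠ-split n (Above t) (λ u → t′ ≤ᵇ key u) ⟩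
    countᶠ n (λ u → Above t u ∧ (t′ ≤ᵇ key u)) + #Between t t′
      ≡⟨ cong (_+ #Between t t′) (countᶠ-cong n upper⇒above above⇒upper) ⟩
    #Above t′ + #Between t t′
      ≡⟨ +-comm (#Above t′) (#Between t t′) ⟩
    #Between t t′ + #Above t′
      ∎
    where
    open ≡-Reasoning
    upper⇒above : ∀ u → T (Above t u ∧ (t′ ≤ᵇ key u)) → T (Above t′ u)
    upper⇒above u h = let above , t′≤ = T-∧⁻ (Above t u) h in T-∧⁺ (t′≤ , proj₂ (T-∧⁻ (t ≤ᵇ key u) above))
    above⇒upper : ∀ u → T (Above t′ u) → T (Above t u ∧ (t′ ≤ᵇ key u))
    above⇒upper u h = T-∧⁺ (above-antitone t≤t′ h , proj₁ (T-∧⁻ (t′ ≤ᵇ key u) h))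

  #Above-step : ∀ t → #Above t ≤ d + #Above (suc t)
  #Above-step t = begin
    #Above t                            ≡⟨ #Above-split (n≤1+n t) ⟩
    #Between t (suc t) + #Above (suc t) ≤⟨ +-monoˡ-≤ (#Above (suc t)) #Between≤d ⟩
    d + #Above (suc t)                  ∎
    where
    open ≤-Reasoning
    in-fibre : ∀ u → T (Between t (suc t) u) → T (Yp u ∧ (key u ≡ᵇ t))
    in-fibre u h = T-∧⁺ (proj₂ (T-∧⁻ (t ≤ᵇ key u) above) ,
      ≡⇒≡ᵇ (key u) t (≤-antisym (≤-pred (between⇒< {t} {suc t} h)) (above⇒≤ above)))
      where above = between⇒above {t} {suc t} h
    #Between≤d : #Between t (suc t) ≤ d
    #Between≤d = ≤-trans (countᶠ-mono n in-fibre) (fibre≤d t)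

  #Above-vanish : ∀ t → B ≤ t → #Above t ≡ 0
  #Above-vanish t B≤t = countᶠ-none n (λ u h → <⇒≱ (key<B u) (≤-trans B≤t (above⇒≤ h)))

  record Spread (j t : ℕ) (S : Subset n) : Set where
    field
      card          : ∣ S ∣ ≡ j
      above         : ∀ {u} → u ∈ₛ S → T (Above t u)
      key-injective : ∀ {u v} → u ∈ₛ S → v ∈ₛ S → key u ≡ key v → u ≡ v

  ∅-spread : ∀ t → Spread 0 t ∅
  ∅-spread t = record
    { card          = ∣⊥∣≡0 n
    ; above         = λ u∈∅ → ⊥-elim (∉⊥ u∈∅)
    ; key-injective = λ u∈∅ _ _ → ⊥-elim (∉⊥ u∈∅)
    }

  below-∉ : ∀ {j t u S} → key u < t → Spread j t S → u ∉ S
  below-∉ k<t S-spread u∈S = <⇒≱ k<t (above⇒≤ (Spread.above S-spread u∈S))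

  ∈⁅x⁆∪p⁻ : ∀ {x y : Fin n} {p} → y ∈ₛ ⁅ x ⁆ ∪ p → y ≡ x ⊎ y ∈ₛ p
  ∈⁅x⁆∪p⁻ {x} {p = p} = Sum.map₁ (x∈⁅y⁆⇒x≡y x) ∘ x∈p∪q⁻ ⁅ x ⁆ p

  ⁅x⁆∪-spread : ∀ {j t t′ u S} → t ≤ t′ → T (Between t t′ u) → Spread j t′ S →
    Spread (suc j) t (⁅ u ⁆ ∪ S)
  ⁅x⁆∪-spread {j} {t} {t′} {u} {S} t≤t′ u-between S-spread = record
    { card          = trans (∣⁅x⁆∪p∣≡1+∣p∣ u S (below-∉ (between⇒< {t} u-between) S-spread)) (cong suc card)
    ; above         = above′
    ; key-injective = λ v∈ w∈ → injective (∈⁅x⁆∪p⁻ v∈) (∈⁅x⁆∪p⁻ w∈)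
    }
    where
    open Spread S-spread
    above′ : ∀ {v} → v ∈ₛ ⁅ u ⁆ ∪ S → T (Above t v)
    above′ v∈ with ∈⁅x⁆∪p⁻ v∈
    ... | inj₁ refl = between⇒above {t} {t′} u-between
    ... | inj₂ v∈S  = above-antitone t≤t′ (above v∈S)
    u-below : ∀ {v} → v ∈ₛ S → key u ≡ key v → ⊥
    u-below v∈S eq = <⇒≱ (between⇒< {t} u-between) (≤-trans (above⇒≤ {t′} (above v∈S)) (≤-reflexive (sym eq)))
    injective : ∀ {v w} → v ≡ u ⊎ v ∈ₛ S → w ≡ u ⊎ w ∈ₛ S → key v ≡ key w → v ≡ w
    injective (inj₁ refl) (inj₁ refl) _  = refl
    injective (inj₁ refl) (inj₂ w∈S)  eq = ⊥-elim (u-below w∈S eq)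
    injective (inj₂ v∈S)  (inj₁ refl) eq = ⊥-elim (u-below v∈S (sym eq))
    injective (inj₂ v∈S)  (inj₂ w∈S)  eq = key-injective v∈S w∈S eq

  ⁅x⁆∪-injectiveOnBlocks : ∀ {j t t′ u u′ S S′} → T (Between t t′ u) → T (Between t t′ u′) →
    Spread j t′ S → Spread j t′ S′ → ⁅ u ⁆ ∪ S ≡ ⁅ u′ ⁆ ∪ S′ → (u , S) ≡ (u′ , S′)
  ⁅x⁆∪-injectiveOnBlocks {t = t} u-between u′-between S-spread S′-spread eq =
    let u≡u′ , S≡S′ = ⁅x⁆∪-injective (below-∉ u< S-spread) (below-∉ u< S′-spread)
                                      (below-∉ u′< S-spread) (below-∉ u′< S′-spread) eq
    in cong₂ _,_ u≡u′ S≡S′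
    where
    u<  = between⇒< {t} u-between
    u′< = between⇒< {t} u′-between

  r≤#Between : ∀ {t t′ X} → t ≤ t′ → r + d + X ≤ #Above t → #Above t′ ≤ d + X →
    r ≤ #Between t t′
  r≤#Between {t} {t′} {X} t≤t′ r+d+X≤ ≤d+X = +-cancelʳ-≤ (d + X) r _ (begin
    r + (d + X)               ≡⟨ +-assoc r d X ⟨
    r + d + X                 ≤⟨ r+d+X≤ ⟩
    #Above t                  ≡⟨ #Above-split t≤t′ ⟩
    #Between t t′ + #Above t′ ≤⟨ +-monoʳ-≤ (#Between t t′) ≤d+X ⟩
    #Between t t′ + (d + X)   ∎)
    where open ≤-Reasoning

  blockProduct : ∀ {j t t′} → t ≤ t′ → (Ss : List (Subset n)) → Unique Ss → All (Spread j t′) Ss →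
    ∃ λ Ss⁺ → Unique Ss⁺ × All (Spread (suc j) t) Ss⁺ × length Ss⁺ ≡ #Between t t′ * length Ss
  blockProduct {j} {t} {t′} t≤t′ Ss Ss! Ss-spread =
    map insert pairs , Unique-map⁺ injective (Unique.cartesianProduct⁺ block! Ss!) ,
    All.map⁺ (All.tabulate (λ {x} → spread x)) , length-Ss⁺
    where
    block : List (Fin n)
    block = filterᵇ (Between t t′) (allFin n)
    block! : Unique block
    block! = Unique.filter⁺ (T? ∘ Between t t′) (Unique.allFin⁺ n)

    pairs : List (Fin n × Subset n)
    pairs = cartesianProduct block Ss

    insert : Fin n × Subset n → Subset n
    insert (u , S) = ⁅ u ⁆ ∪ S

    components : ∀ {x} → x ∈ pairs → T (Between t t′ (proj₁ x)) × Spread j t′ (proj₂ x)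
    components x∈ = let u∈ , S∈ = ∈-cartesianProduct⁻ block Ss x∈
                    in proj₂ (∈-filter⁻ (T? ∘ Between t t′) {xs = allFin n} u∈) , All.lookup Ss-spread S∈

    spread : ∀ x → x ∈ pairs → Spread (suc j) t (insert x)
    spread x x∈ = let u-between , S-spread = components x∈ in ⁅x⁆∪-spread t≤t′ u-between S-spread

    injective : ∀ {x x′} → x ∈ pairs → x′ ∈ pairs → insert x ≡ insert x′ → x ≡ x′
    injective x∈ x′∈ = let u , S = components x∈ ; u′ , S′ = components x′∈
                       in ⁅x⁆∪-injectiveOnBlocks {t = t} u u′ S S′

    length-Ss⁺ : length (map insert pairs) ≡ #Between t t′ * length Ss
    length-Ss⁺ = begin
      length (map insert pairs) ≡⟨ length-map insert pairs ⟩
      length pairs              ≡⟨ length-cartesianProduct block Ss ⟩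
      length block * length Ss  ≡⟨ cong (_* length Ss) (length-filterᵇ-tabulate n id (Between t t′)) ⟩
      #Between t t′ * length Ss ∎
      where open ≡-Reasoning

  spreadSets : ∀ j t → j * (r + d) ≤ #Above t →
    ∃ λ (Ss : List (Subset n)) → Unique Ss × All (Spread j t) Ss × r ^ j ≤ length Ss
  spreadSets zero    t _ = ∅ ∷ [] , All.[] Unique.∷ Unique.[] , ∅-spread t All.∷ All.[] , ≤-refl
  spreadSets (suc j) t r+d+X≤ =
    let X = j * (r + d)
        t′ , t≤t′ , X≤ , ≤d+X = descends-through-window #Above B d X #Above-step #Above-vanish t
                                  (≤-trans (m≤n+m X (r + d)) r+d+X≤)
        Ss , Ss! , Ss-spread , r^j≤ = spreadSets j t′ X≤
        Ss⁺ , Ss⁺! , Ss⁺-spread , length-Ss⁺ = blockProduct t≤t′ Ss Ss! Ss-spread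
    in Ss⁺ , Ss⁺! , Ss⁺-spread ,
       ≤-trans (*-mono-≤ (r≤#Between t≤t′ r+d+X≤ ≤d+X) r^j≤) (≤-reflexive (sym length-Ss⁺))

ProperStarFamily : (G : BipGraph) → SimpleGraph → ℕ → Fin (BipGraph.a G) → Subset (BipGraph.a G) →
  List (Subset (BipGraph.a G)) → Set
ProperStarFamily G H s y Y Ls = Unique Ls × All (λ L → L ⊆ Y × ProperBlueStar G H s y L) Ls

module _ (G : BipGraph) where
  open BipGraph G

  T-lookup⇒∈ : ∀ {u} (Y : Subset a) → T (Vec.lookup Y u) → u ∈ₛ Y
  T-lookup⇒∈ {u} Y h = Vec.lookup⇒[]= u Y (to T-≡ h)

  chosenNbr : Fin b → Fin a → Fin a → Fin b
  chosenNbr w₀ y u with any? (λ w → T? (E y w ∧ E u w))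
  ... | yes (w , _) = w
  ... | no _        = w₀

  chosenNbr-common : ∀ w₀ y u → 1 ≤ codeg G y u →
    T (E y (chosenNbr w₀ y u) ∧ E u (chosenNbr w₀ y u))
  chosenNbr-common w₀ y u 1≤codeg with any? (λ w → T? (E y w ∧ E u w))
  ... | yes (w , common) = common
  ... | no ¬common       = ⊥-elim (¬common (countᶠ-witness b 1≤codeg))

  properStars : ∀ {H : SimpleGraph} s d r {y : Fin a} {Y : Subset a} (w₀ : Fin b) →
    BlueNbrs G H y Y → (∀ w → degB G w ≤ d) → s * (r + d) ≤ ∣ Y ∣ →
    ∃ λ Ls → ProperStarFamily G H s y Y Ls × r ^ s ≤ length Ls
  properStars {H} s d r {y} {Y} w₀ Y-blue degB≤d s[r+d]≤∣Y∣ =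
    let Ss , Ss! , Ss-spread , r^s≤ = spreadSets s 0 (subst (s * (r + d) ≤_) (∣p∣≡countᶠ Y) s[r+d]≤∣Y∣)
    in Ss , (Ss! , All.map star Ss-spread) , r^s≤
    where
    φ : Fin a → Fin b
    φ = chosenNbr w₀ y

    common : ∀ u → T (Vec.lookup Y u) → T (E y (φ u) ∧ E u (φ u))
    common u u∈Y = chosenNbr-common w₀ y u (proj₁ (proj₂ (Y-blue u (T-lookup⇒∈ Y u∈Y))))

    fibre≤d : ∀ t → countᶠ a (λ u → Vec.lookup Y u ∧ (toℕ (φ u) ≡ᵇ t)) ≤ d
    fibre≤d t with t <? b
    ... | yes t<b = ≤-trans (countᶠ-mono a adjacent) (degB≤d (fromℕ< t<b))
      where
      adjacent : ∀ u → T (Vec.lookup Y u ∧ (toℕ (φ u) ≡ᵇ t)) → T (E u (fromℕ< t<b))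
      adjacent u h =
        let u∈Y , φu≡t = T-∧⁻ (Vec.lookup Y u) h
            φu≡w = toℕ-injective (trans (≡ᵇ⇒≡ _ t φu≡t) (sym (toℕ-fromℕ< t<b)))
        in subst (λ w → T (E u w)) φu≡w (proj₂ (T-∧⁻ (E y (φ u)) (common u u∈Y)))
    ... | no t≮b = ≤-trans (≤-reflexive (countᶠ-none a outOfRange)) z≤n
      where
      outOfRange : ∀ u → ¬ T (Vec.lookup Y u ∧ (toℕ (φ u) ≡ᵇ t))
      outOfRange u h = t≮b (subst (_< b) (≡ᵇ⇒≡ _ t (proj₂ (T-∧⁻ (Vec.lookup Y u) h))) (toℕ<n (φ u)))

    open SpreadSets (Vec.lookup Y) (toℕ ∘ φ) b d r (toℕ<n ∘ φ) fibre≤d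

    star : ∀ {L} → Spread s 0 L → L ⊆ Y × ProperBlueStar G H s y L
    star {L} L-spread = L⊆Y , card , (λ u u∈L → Y-blue u (L⊆Y u∈L)) , φ ,
      (λ u u∈L → common u (above u∈L)) , (λ u u′ u∈L u′∈L → key-injective u∈L u′∈L ∘ cong toℕ)
      where
      open Spread L-spread
      L⊆Y : L ⊆ Y
      L⊆Y u∈L = T-lookup⇒∈ Y (above u∈L)

  nonempty-blueNbrs⇒degB>0 : ∀ {H y} {Y : Subset a} → BlueNbrs G H y Y → 1 ≤ ∣ Y ∣ →
    ∃ λ (w : Fin b) → 1 ≤ degB G w
  nonempty-blueNbrs⇒degB>0 {y = y} {Y} Y-blue 1≤∣Y∣ =
    let u , u∈Y  = countᶠ-witness a (subst (1 ≤_) (∣p∣≡countᶠ Y) 1≤∣Y∣)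
        w , y~w~u = countᶠ-witness b (proj₁ (proj₂ (Y-blue u (T-lookup⇒∈ Y u∈Y))))
    in w , countᶠ-pos a u (proj₂ (T-∧⁻ (E y w) y~w~u))

^-distribʳ-* : ∀ m n p → (m * n) ^ p ≡ m ^ p * n ^ p
^-distribʳ-* m n zero    = refl
^-distribʳ-* m n (suc p) = begin
  m * n * (m * n) ^ p       ≡⟨ cong (m * n *_) (^-distribʳ-* m n p) ⟩
  m * n * (m ^ p * n ^ p)   ≡⟨ *-interchange m n (m ^ p) (n ^ p) ⟩
  m * m ^ p * (n * n ^ p)   ∎
  where open ≡-Reasoning

s*[m/2s+d]≤m : ∀ s′ m d → 2 * suc s′ * d ≤ m → suc s′ * (m / (2 * suc s′) + d) ≤ m
s*[m/2s+d]≤m s′ m d 2sd≤m = *-cancelˡ-≤ 2 (begin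
  2 * (s * (r + d))         ≡⟨ expand s r d ⟩
  r * (2 * s) + 2 * s * d   ≤⟨ +-mono-≤ (m/n*n≤m m (2 * s)) 2sd≤m ⟩
  m + m                     ≡⟨ double m ⟩
  2 * m                     ∎)
  where
  open ≤-Reasoning
  s = suc s′
  r = m / (2 * s)
  expand : ∀ s r d → 2 * (s * (r + d)) ≡ r * (2 * s) + 2 * s * d
  expand = solve-∀
  double : ∀ m → m + m ≡ 2 * m
  double = solve-∀

m^s≤[4s]^s*[m/2s]^s : ∀ s′ m → 2 * suc s′ ≤ m →
  m ^ suc s′ ≤ (4 * suc s′) ^ suc s′ * (m / (2 * suc s′)) ^ suc s′
m^s≤[4s]^s*[m/2s]^s s′ m 2s≤m = begin
  m ^ s               ≤⟨ ^-monoˡ-≤ s m≤4sr ⟩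
  (4 * s * r) ^ s     ≡⟨ ^-distribʳ-* (4 * s) r s ⟩
  (4 * s) ^ s * r ^ s ∎
  where
  open ≤-Reasoning
  s = suc s′
  q = 2 * s
  r = m / q
  instance r≢0 : NonZero r
  r≢0 = >-nonZero (m≥n⇒m/n>0 2s≤m)
  double : ∀ s r → r * (2 * s) + r * (2 * s) ≡ 4 * s * r
  double = solve-∀
  m≤4sr : m ≤ 4 * s * r
  m≤4sr = begin
    m             ≡⟨ m≡m%n+[m/n]*n m q ⟩
    m % q + r * q ≤⟨ +-monoˡ-≤ (r * q) (<⇒≤ (m%n<n m q)) ⟩
    q + r * q     ≤⟨ +-monoˡ-≤ (r * q) (m≤n*m q r) ⟩
    r * q + r * q ≡⟨ double s r ⟩
    4 * s * r     ∎

properStarBound : ∀ (G : BipGraph) {H : SimpleGraph} s′ C δ {y} {Y : Subset (BipGraph.a G)} →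
  BlueNbrs G H y Y → (∀ w → degB G w ≤ C * δ) → 2 * suc s′ * (C + 1) * δ ≤ ∣ Y ∣ →
  ∃ λ Ls → ProperStarFamily G H (suc s′) y Y Ls × ∣ Y ∣ ^ suc s′ ≤ (4 * suc s′) ^ suc s′ * length Ls
properStarBound G {H} s′ C δ {y} {Y} Y-blue degB≤Cδ M·δ≤∣Y∣ with 1 ≤? ∣ Y ∣
... | no  1≰∣Y∣ = [] , (Unique.[] , All.[]) ,
                 subst (λ m → m ^ suc s′ ≤ (4 * suc s′) ^ suc s′ * 0) (sym (n<1⇒n≡0 (≰⇒> 1≰∣Y∣))) z≤n
... | yes 1≤∣Y∣ =
  let w₀ , 1≤degB       = nonempty-blueNbrs⇒degB>0 G {H} Y-blue 1≤∣Y∣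
      Ls , family , r^s≤ = properStars G {H} s (C * δ) r w₀ Y-blue degB≤Cδ (s*[m/2s+d]≤m s′ m (C * δ) 2sCδ≤m)
      2s≤m              = 2s≤m-of (≤-trans 1≤degB (degB≤Cδ w₀))
  in Ls , family , ≤-trans (m^s≤[4s]^s*[m/2s]^s s′ m 2s≤m) (*-monoʳ-≤ ((4 * s) ^ s) r^s≤)
  where
  m = ∣ Y ∣
  s = suc s′
  r = m / (2 * s)
  expand : ∀ s C δ → 2 * s * (C + 1) * δ ≡ 2 * s * (C * δ) + 2 * s * δ
  expand = solve-∀
  2sCδ≤m : 2 * s * (C * δ) ≤ m
  2sCδ≤m = ≤-trans (m≤m+n (2 * s * (C * δ)) (2 * s * δ)) (≤-trans (≤-reflexive (sym (expand s C δ))) M·δ≤∣Y∣)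
  2s≤m-of : 1 ≤ C * δ → 2 * s ≤ m
  2s≤m-of 1≤Cδ = begin
    2 * s     ≤⟨ m≤m*n (2 * s) δ {{m*n≢0⇒n≢0 C {{>-nonZero 1≤Cδ}}}} ⟩
    2 * s * δ ≤⟨ m≤n+m (2 * s * δ) (2 * s * (C * δ)) ⟩
    2 * s * (C * δ) + 2 * s * δ ≡⟨ expand s C δ ⟨
    2 * s * (C + 1) * δ ≤⟨ M·δ≤∣Y∣ ⟩
    m         ∎
    where open ≤-Reasoning

coprime-1 : ∀ n → Coprime n 1
coprime-1 n = Coprime.sym (1-coprimeTo n)

ℕ→ℚ≡mkℚ : ∀ n → ℕ→ℚ n ≡ Q.mkℚ (ℤ.+ n) 0 (coprime-1 n)
ℕ→ℚ≡mkℚ n = ℚ.normalize-coprime (coprime-1 n)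

ℕ→ℚ-mono-≤ : ∀ {m n} → m ≤ n → ℕ→ℚ m Q.≤ ℕ→ℚ n
ℕ→ℚ-mono-≤ {m} {n} m≤n rewrite ℕ→ℚ≡mkℚ m | ℕ→ℚ≡mkℚ n =
  Q.*≤* (subst₂ ℤ._≤_ (sym (ℤ.*-identityʳ (ℤ.+ m))) (sym (ℤ.*-identityʳ (ℤ.+ n))) (ℤ.+≤+ m≤n))

ℕ→ℚ-cancel-≤ : ∀ {m n} → ℕ→ℚ m Q.≤ ℕ→ℚ n → m ≤ n
ℕ→ℚ-cancel-≤ {m} {n} le rewrite ℕ→ℚ≡mkℚ m | ℕ→ℚ≡mkℚ n with le
... | Q.*≤* m≤n = ℤ.drop‿+≤+ (subst₂ ℤ._≤_ (ℤ.*-identityʳ (ℤ.+ m)) (ℤ.*-identityʳ (ℤ.+ n)) m≤n)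

ℕ→ℚ-homo-* : ∀ m n → ℕ→ℚ m Q.* ℕ→ℚ n ≡ ℕ→ℚ (m * n)
ℕ→ℚ-homo-* m n rewrite ℕ→ℚ≡mkℚ m | ℕ→ℚ≡mkℚ n = cong (Q._/ 1) (sym (ℤ.pos-* m n))

ℕ→ℚ-cofinal : ∀ K → ∃ λ C → K Q.≤ ℕ→ℚ C
ℕ→ℚ-cofinal (Q.mkℚ (ℤ.+ p) d c) = p , subst (Q.mkℚ (ℤ.+ p) d c Q.≤_) (sym (ℕ→ℚ≡mkℚ p))
  (Q.*≤* (subst₂ ℤ._≤_ (sym (ℤ.*-identityʳ (ℤ.+ p))) (ℤ.pos-* p (suc d)) (ℤ.+≤+ (m≤m*n p (suc d)))))
ℕ→ℚ-cofinal (Q.mkℚ ℤ.-[1+ p ] d c) = 0 , subst (Q.mkℚ ℤ.-[1+ p ] d c Q.≤_) (sym (ℕ→ℚ≡mkℚ 0)) (Q.*≤* ℤ.-≤+)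

x≤K*δ⇒x≤C*δ : ∀ {K} C {x} δ → K Q.≤ ℕ→ℚ C → ℕ→ℚ x Q.≤ K Q.* ℕ→ℚ δ → x ≤ C * δ
x≤K*δ⇒x≤C*δ {K} C {x} δ K≤C x≤Kδ = ℕ→ℚ-cancel-≤ (ℚ.≤-trans x≤Kδ (begin
  K Q.* ℕ→ℚ δ       ≤⟨ ℚ.*-monoʳ-≤-nonNeg (ℕ→ℚ δ) {{δ≥0}} K≤C ⟩
  ℕ→ℚ C Q.* ℕ→ℚ δ   ≡⟨ ℕ→ℚ-homo-* C δ ⟩
  ℕ→ℚ (C * δ)       ∎))
  where
  open ℚ.≤-Reasoning
  δ≥0 : Q.NonNegative (ℕ→ℚ δ)
  δ≥0 rewrite ℕ→ℚ≡mkℚ δ = _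

1/ℕ : (P : ℕ) → .{{NonZero P}} → Q.ℚ
1/ℕ (suc k) = Q.1/ Q.mkℚ (ℤ.+ suc k) 0 (coprime-1 (suc k))

1/ℕ-pos : ∀ P .{{_ : NonZero P}} → Q.0ℚ Q.< 1/ℕ P
1/ℕ-pos (suc k) = ℚ.positive⁻¹ (1/ℕ (suc k))

1/ℕ-*-≤ : ∀ P .{{_ : NonZero P}} {X L} → X ≤ P * L → 1/ℕ P Q.* ℕ→ℚ X Q.≤ ℕ→ℚ L
1/ℕ-*-≤ P@(suc k) {X} {L} X≤PL = begin
  1/ℕ P Q.* ℕ→ℚ X               ≤⟨ ℚ.*-monoˡ-≤-nonNeg (1/ℕ P) (ℕ→ℚ-mono-≤ X≤PL) ⟩
  1/ℕ P Q.* ℕ→ℚ (P * L)         ≡⟨ cong (1/ℕ P Q.*_) (ℕ→ℚ-homo-* P L) ⟨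
  1/ℕ P Q.* (ℕ→ℚ P Q.* ℕ→ℚ L)   ≡⟨ ℚ.*-assoc (1/ℕ P) (ℕ→ℚ P) (ℕ→ℚ L) ⟨
  1/ℕ P Q.* ℕ→ℚ P Q.* ℕ→ℚ L     ≡⟨ cong (λ p → 1/ℕ P Q.* p Q.* ℕ→ℚ L) (ℕ→ℚ≡mkℚ P) ⟩
  P⁻¹P Q.* ℕ→ℚ L                ≡⟨ cong (Q._* ℕ→ℚ L) (ℚ.*-inverseˡ (Q.mkℚ (ℤ.+ P) 0 (coprime-1 P))) ⟩
  Q.1ℚ Q.* ℕ→ℚ L                ≡⟨ ℚ.*-identityˡ (ℕ→ℚ L) ⟩
  ℕ→ℚ L                         ∎
  where
  open ℚ.≤-Reasoning
  P⁻¹P = 1/ℕ P Q.* Q.mkℚ (ℤ.+ P) 0 (coprime-1 P)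

lemma2p7 : (H : SimpleGraph) (s : ℕ) → 1 ≤ s → (K : Q.ℚ) → Q.1ℚ Q.≤ K →
    (seq : ℕ → Instance) (δ : ℕ → ℕ) →
    (∀ n → AlmostRegular (Instance.G (seq n)) K (δ n)) →
    (∀ n → BlueNbrs (Instance.G (seq n)) H (Instance.y (seq n)) (Instance.Y (seq n))) →
    (∀ M → ∃ λ N → ∀ n → N ≤ n → M * δ n ≤ ∣ Instance.Y (seq n) ∣) →
    ∃ λ (c : Q.ℚ) → Q.0ℚ Q.< c × (∃ λ N → ∀ n → N ≤ n →
      StarCountAtLeast (Instance.G (seq n)) H s (Instance.y (seq n)) (Instance.Y (seq n))
        (c Q.* ℕ→ℚ (∣ Instance.Y (seq n) ∣ ^ s)))
lemma2p7 H (suc s′) _ K _ seq δ almostRegular blueNbrs growth = 1/ℕ P , 1/ℕ-pos P , N , starCount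
  where
  C = proj₁ (ℕ→ℚ-cofinal K)
  M = 2 * suc s′ * (C + 1)
  N = proj₁ (growth M)
  P = (4 * suc s′) ^ suc s′
  instance P≢0 : NonZero P
  P≢0 = m^n≢0 (4 * suc s′) (suc s′)
  starCount : ∀ n → N ≤ n → StarCountAtLeast (Instance.G (seq n)) H (suc s′) (Instance.y (seq n))
    (Instance.Y (seq n)) (1/ℕ P Q.* ℕ→ℚ (∣ Instance.Y (seq n) ∣ ^ suc s′))
  starCount n N≤n =
    let open Instance (seq n)
        degB≤Cδ : ∀ w → degB G w ≤ C * δ n
        degB≤Cδ w = x≤K*δ⇒x≤C*δ C (δ n) (proj₂ (ℕ→ℚ-cofinal K)) (proj₂ (proj₂ (almostRegular n)) w)
        Ls , (Ls! , Ls-stars) , bound =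
          properStarBound G {H} s′ C (δ n) (blueNbrs n) degB≤Cδ (proj₂ (growth M) n N≤n)
    in Ls , Ls! , Ls-stars , 1/ℕ-*-≤ P bound
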